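{- Let $m,n$ be positive integers and let $W=W^{(m)}_n$. For every $\gamma\in A_0$, the sequence $f_0(\gamma)$ satisfies $\mathrm{area}(f_0(\gamma))=\mathrm{area}(\gamma)-1$ and $\mathrm{dinv}_m(f_0(\gamma))=\mathrm{dinv}_m(\gamma)+1$.
   Context: An $m$-Dyck word of length $n$ is a sequence $\gamma=(\gamma_0,\dots,\gamma_{n-1})$ of nonnegative integers with $\gamma_0=0$ and $\gamma_i\le\gamma_{i-1}+m$ for $1\le i<n$; $W^{(m)}_n$ is the set of these. $\mathrm{area}(\gamma)=\sum_i\gamma_i$ (also for arbitrary integer sequences), and $\mathrm{dinv}_m(\gamma)=\sum_{0\le i<j<n}\mathrm{sc}_m(\gamma_i-\gamma_j)$, where $\mathrm{sc}_m(p)=m+1-p$ if $1\le p\le m$, $\mathrm{sc}_m(p)=m+p$ if $-m\le p\le0$, and $\mathrm{sc}_m(p)=0$ otherwise. For $\gamma\in W$, let $r=r(\gamma)$ be the minimum index $i\in\{2,3,\dots,n-1\}$ with $\gamma_i-\gamma_{i-2}\le m$, or $r=n$ if no such index exists. Let $A_0$ be the set of $\gamma\in W$ with $\gamma_{r-1}-1\le\gamma_{n-1}+m$ and $\gamma_1>0$. For $\gamma\in A_0$ define $f_0(\gamma)=(\gamma_0,\gamma_1,\dots,\gamma_{r-2},\gamma_r,\gamma_{r+1},\dots,\gamma_{n-1},\gamma_{r-1}-1)$. -}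

module Defs where

open import Data.Nat as ℕ using (ℕ; zero; suc)
open import Data.Integer as ℤ using (ℤ; +_; _-_; _≤?_; -_)
open import Data.List using (List; []; _∷_; length; map; take; drop; _++_; [_])
open import Data.Bool using (Bool; true; false; if_then_else_)
open import Relation.Nullary.Decidable using (⌊_⌋)
open import Data.Product using (_×_)

-- 0-indexed list access with default 0 (only used at in-range indices below)
at : List ℤ → ℕ → ℤ
at []       _       = + 0
at (x ∷ xs) zero    = x
at (x ∷ xs) (suc i) = at xs i

toℤs : List ℕ → List ℤ
toℤs = map +_

sumℤ : List ℤ → ℤ
sumℤ []       = + 0
sumℤ (x ∷ xs) = x ℤ.+ sumℤ xs

area : List ℤ → ℤ
area = sumℤ

sc : ℕ → ℤ → ℤ
sc m p =
  if ⌊ + 1 ≤? p ⌋ ∧' ⌊ p ≤? + m ⌋ then (+ m ℤ.+ + 1) - p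
  else if ⌊ - (+ m) ≤? p ⌋ ∧' ⌊ p ≤? + 0 ⌋ then + m ℤ.+ p
  else + 0
  where
  _∧'_ : Bool → Bool → Bool
  true  ∧' b = b
  false ∧' _ = false

dinv : ℕ → List ℤ → ℤ
dinv m []       = + 0
dinv m (x ∷ xs) = sumℤ (map (λ y → sc m (x - y)) xs) ℤ.+ dinv m xs

IsDyck : ℕ → ℕ → List ℕ → Set
IsDyck m n γ =
  length γ ≡ n × at (toℤs γ) 0 ≡ + 0 ×
  (∀ i → 1 ℕ.≤ i → i ℕ.< n → at (toℤs γ) i ℤ.≤ at (toℤs γ) (i ℕ.∸ 1) ℤ.+ + m)
  where open import Relation.Binary.PropositionalEquality using (_≡_)

-- r(γ): minimal index i ∈ {2,…,n-1} with γ_i - γ_{i-2} ≤ m, or n if none.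
rIdx : ℕ → List ℤ → ℕ
rIdx m (a ∷ b ∷ c ∷ rest) =
  if ⌊ c - a ≤? + m ⌋ then 2 else suc (rIdx m (b ∷ c ∷ rest))
rIdx m xs = length xs

InA0 : ℕ → ℕ → List ℕ → Set
InA0 m n γ =
  IsDyck m n γ ×
  (at g (rIdx m g ℕ.∸ 1) - + 1 ℤ.≤ at g (n ℕ.∸ 1) ℤ.+ + m) ×
  (+ 0 ℤ.< at g 1)
  where g = toℤs γ

f0 : ℕ → List ℕ → List ℤ
f0 m γ = take (r ℕ.∸ 1) g ++ drop r g ++ [ at g (r ℕ.∸ 1) - + 1 ]
  where
  g = toℤs γ
  r = rIdx m g

-- For 2 ≤ i < r we have γᵢ > γᵢ₋₂ + m ≥ γᵢ₋₁, so γ₀ < γ₁ < ⋯ < γ_{r−1}; moreover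
-- γ_{r−2} < γ_{r−1} ≤ γ_{r−2} + m, while γ_{r−1} > γᵢ + m for every i ≤ r − 3.
-- Moving a = γ_{r−1} to the end as a − 1 only affects the dinv-pairs containing it:
-- a pair with a later entry y keeps its weight because sc_m(1 − p) = sc_m(p), a pair
-- with γᵢ (i ≤ r − 3) has weight 0 before and after, and the pair with γ_{r−2} gains
-- exactly 1.
module Submission where

open import Defs
open import Data.Nat as ℕ using (ℕ; suc; s≤s; z≤n)
open import Data.Integer using (ℤ; +_; -_; _+_; _-_; _≤_; _<_; _≤?_; _<?_; 0ℤ; +≤+; +<+)
import Data.Integer.Properties as ℤP
open import Data.Integer.Tactic.RingSolver using (solve-∀)
open import Algebra.Properties.CommutativeSemigroup ℤP.+-commutativeSemigroup using (interchange)
open import Data.List using (List; []; _∷_; _++_; [_]; map; take; drop; length)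
open import Data.List.Properties using (map-++; map-cong; length-map)
open import Data.List.Relation.Unary.All using (All; []; _∷_)
open import Data.List.Relation.Unary.Linked using (Linked; []; [-]; _∷_)
open import Data.Product using (_×_; _,_)
open import Relation.Nullary using (¬_; yes; no; contradiction)
open import Relation.Binary.PropositionalEquality
  using (_≡_; refl; sym; trans; cong; cong₂; subst; module ≡-Reasoning)
open ≡-Reasoning

-- Linear facts are obtained by transporting one inequality along a ring identity
-- between the two gaps. Such identities are stated for an arbitrary k : ℤ in place
-- of + M, because the ring solver cannot treat + M as an atom.
≤-by-gap : ∀ {a b c d : ℤ} → c ≤ d → d - c ≡ b - a → a ≤ b
≤-by-gap c≤d gap = ℤP.0≤i-j⇒j≤i (subst (0ℤ ≤_) gap (ℤP.i≤j⇒0≤j-i c≤d))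

sc-pos : ∀ M {q} → + 1 ≤ q → q ≤ + M → sc M q ≡ + M + + 1 - q
sc-pos M {q} 1≤q q≤M with + 1 ≤? q | q ≤? + M
... | yes _    | yes _    = refl
... | no 1≰q   | _        = contradiction 1≤q 1≰q
... | yes _    | no q≰M   = contradiction q≤M q≰M

sc-nonpos : ∀ M {q} → - + M ≤ q → q ≤ 0ℤ → sc M q ≡ + M + q
sc-nonpos M {q} -M≤q q≤0 with + 1 ≤? q
... | yes 1≤q with +≤+ () ← ℤP.≤-trans 1≤q q≤0
... | no _ with - + M ≤? q | q ≤? 0ℤ
...   | yes _    | yes _   = refl
...   | no -M≰q  | _       = contradiction -M≤q -M≰q
...   | yes _    | no q≰0  = contradiction q≤0 q≰0

sc-above : ∀ M {q} → + M < q → sc M q ≡ 0ℤ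
sc-above M {q} M<q with + 1 ≤? q | q ≤? + M
... | no 1≰q | _       = contradiction (ℤP.≤-trans (+≤+ (s≤s z≤n)) (ℤP.i<j⇒suc[i]≤j M<q)) 1≰q
... | yes _  | yes q≤M = contradiction q≤M (ℤP.<⇒≱ M<q)
... | yes _  | no _ with - + M ≤? q | q ≤? 0ℤ
...   | yes _ | yes q≤0 = contradiction (ℤP.≤-trans q≤0 (+≤+ z≤n)) (ℤP.<⇒≱ M<q)
...   | yes _ | no _    = refl
...   | no _  | _       = refl

sc-below : ∀ M {q} → q ≤ - + M → sc M q ≡ 0ℤ
sc-below M {q} q≤-M with + 1 ≤? q
... | yes 1≤q with +≤+ () ← ℤP.≤-trans 1≤q (ℤP.≤-trans q≤-M (ℤP.neg-≤-pos {M} {0}))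
... | no _ with - + M ≤? q | q ≤? 0ℤ
...   | yes -M≤q | yes _ = trans (cong (_+_ (+ M)) (ℤP.≤-antisym q≤-M -M≤q)) (ℤP.+-inverseʳ (+ M))
...   | yes _    | no _  = refl
...   | no _     | _     = refl

sc-reflect-nonpos : ∀ M {q} → q ≤ 0ℤ → sc M (+ 1 - q) ≡ sc M q
sc-reflect-nonpos M {q} q≤0 with q ≤? - + M
... | yes q≤-M = trans (sc-above M M<1-q) (sym (sc-below M q≤-M))
  where
  gap : ∀ k q → - k - q ≡ (+ 1 - q) - (+ 1 + k)
  gap = solve-∀
  M<1-q : + M < + 1 - q
  M<1-q = ℤP.suc[i]≤j⇒i<j (≤-by-gap q≤-M (gap (+ M) q))
... | no q≰-M = begin
  sc M (+ 1 - q)          ≡⟨ sc-pos M (≤-by-gap q≤0 (gap₁ q)) 1-q≤M ⟩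
  + M + + 1 - (+ 1 - q)   ≡⟨ value (+ M) q ⟩
  + M + q                 ≡⟨ sc-nonpos M (ℤP.<⇒≤ -M<q) q≤0 ⟨
  sc M q                  ∎
  where
  gap₁ : ∀ q → 0ℤ - q ≡ (+ 1 - q) - + 1
  gap₁ = solve-∀
  gap₂ : ∀ k q → q - (+ 1 + - k) ≡ k - (+ 1 - q)
  gap₂ = solve-∀
  value : ∀ k q → k + + 1 - (+ 1 - q) ≡ k + q
  value = solve-∀
  -M<q : - + M < q
  -M<q = ℤP.≰⇒> q≰-M
  1-q≤M : + 1 - q ≤ + M
  1-q≤M = ≤-by-gap (ℤP.i<j⇒suc[i]≤j -M<q) (gap₂ (+ M) q)

sc-reflect : ∀ M q → sc M (+ 1 - q) ≡ sc M q
sc-reflect M q with 0ℤ <? q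
... | no 0≮q  = sc-reflect-nonpos M (ℤP.≮⇒≥ 0≮q)
... | yes 0<q = begin
  sc M (+ 1 - q)             ≡⟨ sc-reflect-nonpos M 1-q≤0 ⟨
  sc M (+ 1 - (+ 1 - q))     ≡⟨ cong (sc M) (involutive q) ⟩
  sc M q                     ∎
  where
  involutive : ∀ q → + 1 - (+ 1 - q) ≡ q
  involutive = solve-∀
  gap : ∀ q → q - + 1 ≡ 0ℤ - (+ 1 - q)
  gap = solve-∀
  1-q≤0 : + 1 - q ≤ 0ℤ
  1-q≤0 = ≤-by-gap (ℤP.i<j⇒suc[i]≤j 0<q) (gap q)

sc-suc-nonpos : ∀ M {q} → - + M ≤ q → q < 0ℤ → sc M (+ 1 + q) ≡ sc M q + + 1
sc-suc-nonpos M {q} -M≤q q<0 = begin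
  sc M (+ 1 + q)     ≡⟨ sc-nonpos M (ℤP.i≤j⇒i≤1+j -M≤q) (ℤP.i<j⇒suc[i]≤j q<0) ⟩
  + M + (+ 1 + q)    ≡⟨ shift (+ M) q ⟩
  + M + q + + 1      ≡⟨ cong (_+ + 1) (sc-nonpos M -M≤q (ℤP.<⇒≤ q<0)) ⟨
  sc M q + + 1       ∎
  where
  shift : ∀ k q → k + (+ 1 + q) ≡ k + q + + 1
  shift = solve-∀

sc-suc-below : ∀ M {q} → q < - + M → sc M (+ 1 + q) ≡ sc M q
sc-suc-below M q<-M = trans (sc-below M (ℤP.i<j⇒suc[i]≤j q<-M)) (sym (sc-below M (ℤP.<⇒≤ q<-M)))

lower-as-suc : ∀ x a → x - (a - + 1) ≡ + 1 + (x - a)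
lower-as-suc = solve-∀

sc-lower-swap : ∀ M a y → sc M (y - (a - + 1)) ≡ sc M (a - y)
sc-lower-swap M a y = trans (cong (sc M) (reflect a y)) (sc-reflect M (a - y))
  where
  reflect : ∀ a y → y - (a - + 1) ≡ + 1 - (a - y)
  reflect = solve-∀

sc-lower-near : ∀ M {x a} → x < a → a ≤ x + + M → sc M (x - (a - + 1)) ≡ sc M (x - a) + + 1
sc-lower-near M {x} {a} x<a a≤x+M =
  trans (cong (sc M) (lower-as-suc x a)) (sc-suc-nonpos M -M≤x-a x-a<0)
  where
  gap₁ : ∀ k x a → x + k - a ≡ x - a - - k
  gap₁ = solve-∀
  gap₂ : ∀ x a → a - (+ 1 + x) ≡ 0ℤ - (+ 1 + (x - a))
  gap₂ = solve-∀
  -M≤x-a : - + M ≤ x - a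
  -M≤x-a = ≤-by-gap a≤x+M (gap₁ (+ M) x a)
  x-a<0 : x - a < 0ℤ
  x-a<0 = ℤP.suc[i]≤j⇒i<j (≤-by-gap (ℤP.i<j⇒suc[i]≤j x<a) (gap₂ x a))

sc-lower-far : ∀ M {x a} → x + + M < a → sc M (x - (a - + 1)) ≡ sc M (x - a)
sc-lower-far M {x} {a} x+M<a =
  trans (cong (sc M) (lower-as-suc x a)) (sc-suc-below M x-a<-M)
  where
  gap : ∀ k x a → a - (+ 1 + (x + k)) ≡ - k - (+ 1 + (x - a))
  gap = solve-∀
  x-a<-M : x - a < - + M
  x-a<-M = ℤP.suc[i]≤j⇒i<j (≤-by-gap (ℤP.i<j⇒suc[i]≤j x+M<a) (gap (+ M) x a))

∑ : List ℤ → (ℤ → ℤ) → ℤ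
∑ xs f = sumℤ (map f xs)

syntax ∑ xs (λ x → e) = ∑[ x ∈ xs ] e

sumℤ-++ : ∀ xs ys → sumℤ (xs ++ ys) ≡ sumℤ xs + sumℤ ys
sumℤ-++ []       ys = sym (ℤP.+-identityˡ (sumℤ ys))
sumℤ-++ (x ∷ xs) ys = trans (cong (_+_ x) (sumℤ-++ xs ys)) (sym (ℤP.+-assoc x (sumℤ xs) (sumℤ ys)))

∑-++ : ∀ xs ys f → ∑ (xs ++ ys) f ≡ ∑ xs f + ∑ ys f
∑-++ xs ys f = trans (cong sumℤ (map-++ f xs ys)) (sumℤ-++ (map f xs) (map f ys))

∑-cong : ∀ {f g} xs → (∀ x → f x ≡ g x) → ∑ xs f ≡ ∑ xs g
∑-cong xs f≗g = cong sumℤ (map-cong f≗g xs)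

∑-+ : ∀ xs f g → ∑[ x ∈ xs ] (f x + g x) ≡ ∑ xs f + ∑ xs g
∑-+ []       f g = refl
∑-+ (x ∷ xs) f g = trans (cong (_+_ (f x + g x)) (∑-+ xs f g)) (interchange (f x) (g x) (∑ xs f) (∑ xs g))

cross : ℕ → List ℤ → List ℤ → ℤ
cross M xs ys = ∑[ x ∈ xs ] ∑[ y ∈ ys ] sc M (x - y)

cross-++ʳ : ∀ M xs ys zs → cross M xs (ys ++ zs) ≡ cross M xs ys + cross M xs zs
cross-++ʳ M xs ys zs =
  trans (∑-cong xs (λ x → ∑-++ ys zs (λ y → sc M (x - y)))) (∑-+ xs _ _)

cross-[-] : ∀ M xs c → cross M xs [ c ] ≡ ∑[ x ∈ xs ] sc M (x - c)
cross-[-] M xs c = ∑-cong xs (λ x → ℤP.+-identityʳ (sc M (x - c)))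

dinv-++ : ∀ M xs ys → dinv M (xs ++ ys) ≡ dinv M xs + cross M xs ys + dinv M ys
dinv-++ M []       ys = sym (ℤP.+-identityˡ (dinv M ys))
dinv-++ M (x ∷ xs) ys = begin
  ∑ (xs ++ ys) scₓ + dinv M (xs ++ ys)
    ≡⟨ cong₂ _+_ (∑-++ xs ys scₓ) (dinv-++ M xs ys) ⟩
  ∑ xs scₓ + ∑ ys scₓ + (dinv M xs + cross M xs ys + dinv M ys)
    ≡⟨ regroup (∑ xs scₓ) (∑ ys scₓ) (dinv M xs) (cross M xs ys) (dinv M ys) ⟩
  ∑ xs scₓ + dinv M xs + (∑ ys scₓ + cross M xs ys) + dinv M ys
    ∎
  where
  scₓ : ℤ → ℤ
  scₓ y = sc M (x - y)
  regroup : ∀ s t d c e → s + t + (d + c + e) ≡ s + d + (t + c) + e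
  regroup = solve-∀

area-lowerToEnd : ∀ P a R → area (P ++ R ++ [ a - + 1 ]) ≡ area (P ++ a ∷ R) - + 1
area-lowerToEnd P a R = begin
  sumℤ (P ++ R ++ [ a - + 1 ])              ≡⟨ sumℤ-++ P (R ++ [ a - + 1 ]) ⟩
  sumℤ P + sumℤ (R ++ [ a - + 1 ])          ≡⟨ cong (_+_ (sumℤ P)) (sumℤ-++ R [ a - + 1 ]) ⟩
  sumℤ P + (sumℤ R + (a - + 1 + 0ℤ))        ≡⟨ regroup (sumℤ P) (sumℤ R) a ⟩
  sumℤ P + (a + sumℤ R) - + 1               ≡⟨ cong (_- + 1) (sumℤ-++ P (a ∷ R)) ⟨
  sumℤ (P ++ a ∷ R) - + 1                   ∎
  where
  regroup : ∀ p r a → p + (r + (a - + 1 + 0ℤ)) ≡ p + (a + r) - + 1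
  regroup = solve-∀

dinv-lowerToEnd : ∀ M P a R →
  ∑[ x ∈ P ] sc M (x - (a - + 1)) ≡ ∑[ x ∈ P ] sc M (x - a) + + 1 →
  dinv M (P ++ R ++ [ a - + 1 ]) ≡ dinv M (P ++ a ∷ R) + + 1
dinv-lowerToEnd M P a R gain = begin
  dinv M (P ++ R ++ [ a' ])
    ≡⟨ dinv-++ M P (R ++ [ a' ]) ⟩
  dinv M P + cross M P (R ++ [ a' ]) + dinv M (R ++ [ a' ])
    ≡⟨ cong₂ (λ c d → dinv M P + c + d) cross-lowered dinv-lowered ⟩
  dinv M P + (cross M P R + (toA + + 1)) + (dinv M R + fromA + 0ℤ)
    ≡⟨ regroup (dinv M P) (cross M P R) toA (dinv M R) fromA ⟩
  dinv M P + (toA + cross M P R) + (fromA + dinv M R) + + 1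
    ≡⟨ cong (λ c → dinv M P + c + dinv M (a ∷ R) + + 1) cross-∷ ⟨
  dinv M P + cross M P (a ∷ R) + dinv M (a ∷ R) + + 1
    ≡⟨ cong (_+ + 1) (dinv-++ M P (a ∷ R)) ⟨
  dinv M (P ++ a ∷ R) + + 1
    ∎
  where
  a' = a - + 1
  toA = ∑[ x ∈ P ] sc M (x - a)
  fromA = ∑[ y ∈ R ] sc M (a - y)
  cross-lowered : cross M P (R ++ [ a' ]) ≡ cross M P R + (toA + + 1)
  cross-lowered = trans (cross-++ʳ M P R [ a' ]) (cong (_+_ (cross M P R)) (trans (cross-[-] M P a') gain))
  dinv-lowered : dinv M (R ++ [ a' ]) ≡ dinv M R + fromA + 0ℤ
  dinv-lowered = trans (dinv-++ M R [ a' ])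
    (cong (λ c → dinv M R + c + 0ℤ) (trans (cross-[-] M R a') (∑-cong R (sc-lower-swap M a))))
  cross-∷ : cross M P (a ∷ R) ≡ toA + cross M P R
  cross-∷ = trans (cross-++ʳ M P [ a ] R) (cong (_+ cross M P R) (cross-[-] M P a))
  regroup : ∀ d c s e t → d + (c + (s + + 1)) + (e + t + 0ℤ) ≡ d + (s + c) + (t + e) + + 1
  regroup = solve-∀

lowerToEnd : ℕ → List ℤ → List ℤ
lowerToEnd k u = take (k ℕ.∸ 1) u ++ drop k u ++ [ at u (k ℕ.∸ 1) - + 1 ]

lowerToEnd-++ : ∀ P a R → lowerToEnd (suc (length P)) (P ++ a ∷ R) ≡ P ++ R ++ [ a - + 1 ]
lowerToEnd-++ []      a R = refl
lowerToEnd-++ (x ∷ P) a R = cong (x ∷_) (lowerToEnd-++ P a R)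

pivot-gain : ∀ M {far near a} → All (λ x → x + + M < a) far → near < a → a ≤ near + + M →
  ∑[ x ∈ far ++ [ near ] ] sc M (x - (a - + 1)) ≡ ∑[ x ∈ far ++ [ near ] ] sc M (x - a) + + 1
pivot-gain M {near = near} {a} [] near<a a≤near+M = begin
  sc M (near - (a - + 1)) + 0ℤ   ≡⟨ ℤP.+-identityʳ (sc M (near - (a - + 1))) ⟩
  sc M (near - (a - + 1))        ≡⟨ sc-lower-near M near<a a≤near+M ⟩
  sc M (near - a) + + 1          ≡⟨ cong (_+ + 1) (ℤP.+-identityʳ (sc M (near - a))) ⟨
  sc M (near - a) + 0ℤ + + 1     ∎
pivot-gain M {x ∷ far} {a = a} (x+M<a ∷ far+M<a) near<a a≤near+M =
  trans (cong₂ _+_ (sc-lower-far M {x} x+M<a) (pivot-gain M far+M<a near<a a≤near+M))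
        (sym (ℤP.+-assoc (sc M (x - a)) _ (+ 1)))

rIdx-stop : ∀ M a b c rest → c - a ≤ + M → rIdx M (a ∷ b ∷ c ∷ rest) ≡ 2
rIdx-stop M a b c rest c-a≤M with c - a ≤? + M
... | yes _    = refl
... | no c-a≰M = contradiction c-a≤M c-a≰M

rIdx-skip : ∀ M a b c rest → ¬ (c - a ≤ + M) → rIdx M (a ∷ b ∷ c ∷ rest) ≡ suc (rIdx M (b ∷ c ∷ rest))
rIdx-skip M a b c rest c-a≰M with c - a ≤? + M
... | yes c-a≤M = contradiction c-a≤M c-a≰M
... | no _      = refl

DyckStep : ℕ → ℤ → ℤ → Set
DyckStep M x y = y ≤ x + + M

record PivotSplit (M : ℕ) (u : List ℤ) : Set where
  field
    far          : List ℤ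
    near pivot   : ℤ
    rest         : List ℤ
    u≡           : u ≡ (far ++ [ near ]) ++ pivot ∷ rest
    rIdx≡        : rIdx M u ≡ suc (length (far ++ [ near ]))
    far+M<pivot  : All (λ x → x + + M < pivot) far
    near<pivot   : near < pivot
    pivot≤near+M : pivot ≤ near + + M
    -- the invariant that lets the split be extended by one entry on the left
    second≤pivot : at u 1 ≤ pivot

pivotAtStart : ∀ {M} y₀ y₁ ys → rIdx M (y₀ ∷ y₁ ∷ ys) ≡ 2 → y₀ < y₁ → y₁ ≤ y₀ + + M →
  PivotSplit M (y₀ ∷ y₁ ∷ ys)
pivotAtStart y₀ y₁ ys rIdx≡2 y₀<y₁ y₁≤y₀+M = record
  { far = [] ; near = y₀ ; pivot = y₁ ; rest = ys ; u≡ = refl ; rIdx≡ = rIdx≡2 ; far+M<pivot = []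
  ; near<pivot = y₀<y₁ ; pivot≤near+M = y₁≤y₀+M ; second≤pivot = ℤP.≤-refl }

pivotSplit : ∀ {M} y₀ y₁ ys → Linked (DyckStep M) (y₀ ∷ y₁ ∷ ys) → y₀ < y₁ →
  PivotSplit M (y₀ ∷ y₁ ∷ ys)
pivotSplit y₀ y₁ [] (y₁≤y₀+M ∷ _) y₀<y₁ = pivotAtStart y₀ y₁ [] refl y₀<y₁ y₁≤y₀+M
pivotSplit {M} y₀ y₁ (y₂ ∷ ys) (y₁≤y₀+M ∷ steps) y₀<y₁ with y₂ - y₀ ≤? + M
... | yes y₂-y₀≤M = pivotAtStart y₀ y₁ (y₂ ∷ ys) (rIdx-stop M y₀ y₁ y₂ ys y₂-y₀≤M) y₀<y₁ y₁≤y₀+M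
... | no y₂-y₀≰M = record
  { far = y₀ ∷ far ; near = near ; pivot = pivot ; rest = rest
  ; u≡ = cong (y₀ ∷_) u≡
  ; rIdx≡ = trans (rIdx-skip M y₀ y₁ y₂ ys y₂-y₀≰M) (cong suc rIdx≡)
  ; far+M<pivot = ℤP.<-≤-trans y₀+M<y₂ second≤pivot ∷ far+M<pivot
  ; near<pivot = near<pivot ; pivot≤near+M = pivot≤near+M
  ; second≤pivot = ℤP.≤-trans (ℤP.<⇒≤ y₁<y₂) second≤pivot }
  where
  gap : ∀ k y₀ y₂ → y₂ - y₀ - (+ 1 + k) ≡ y₂ - (+ 1 + (y₀ + k))
  gap = solve-∀
  y₀+M<y₂ : y₀ + + M < y₂
  y₀+M<y₂ = ℤP.suc[i]≤j⇒i<j (≤-by-gap (ℤP.i<j⇒suc[i]≤j (ℤP.≰⇒> y₂-y₀≰M)) (gap (+ M) y₀ y₂))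
  y₁<y₂ : y₁ < y₂
  y₁<y₂ = ℤP.≤-<-trans y₁≤y₀+M y₀+M<y₂
  open PivotSplit (pivotSplit y₁ y₂ ys steps y₁<y₂)

linked-from-at : ∀ {M} u → (∀ i → 1 ℕ.≤ i → i ℕ.< length u → DyckStep M (at u (i ℕ.∸ 1)) (at u i)) →
  Linked (DyckStep M) u
linked-from-at []          _    = []
linked-from-at (x ∷ [])    _    = [-]
linked-from-at (x ∷ y ∷ u) step = step 1 (s≤s z≤n) (s≤s (s≤s z≤n)) ∷ linked-from-at (y ∷ u) step′
  where
  step′ : ∀ i → 1 ℕ.≤ i → i ℕ.< length (y ∷ u) → DyckStep _ (at (y ∷ u) (i ℕ.∸ 1)) (at (y ∷ u) i)
  step′ (suc i) _ i<len = step (suc (suc i)) (s≤s z≤n) (s≤s i<len)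

lemma3p3 : (m n : ℕ) → (γ : List ℕ) → InA0 (suc m) (suc n) γ →
    (area (f0 (suc m) γ) ≡ area (toℤs γ) - + 1) ×
    (dinv (suc m) (f0 (suc m) γ) ≡ dinv (suc m) (toℤs γ) + + 1)
lemma3p3 m n []           (_ , _ , +<+ ())
lemma3p3 m n (_ ∷ [])     (_ , _ , +<+ ())
lemma3p3 m n γ@(c₀ ∷ c₁ ∷ cs) ((length≡ , γ₀≡0 , dyck) , _ , 0<γ₁) =
  trans (cong area f0≡) (trans (area-lowerToEnd P pivot rest) (cong (λ v → area v - + 1) (sym u≡))) ,
  trans (cong (dinv M) f0≡)
        (trans (dinv-lowerToEnd M P pivot rest (pivot-gain M far+M<pivot near<pivot pivot≤near+M))
               (cong (λ v → dinv M v + + 1) (sym u≡)))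
  where
  M = suc m
  steps : Linked (DyckStep M) (toℤs γ)
  steps = linked-from-at (toℤs γ) λ i 1≤i i<len →
    dyck i 1≤i (subst (i ℕ.<_) (trans (length-map +_ γ) length≡) i<len)
  open PivotSplit (pivotSplit (+ c₀) (+ c₁) (toℤs cs) steps (subst (_< + c₁) (sym γ₀≡0) 0<γ₁))
  P = far ++ [ near ]
  f0≡ : f0 M γ ≡ P ++ rest ++ [ pivot - + 1 ]
  f0≡ = trans (cong₂ lowerToEnd rIdx≡ u≡) (lowerToEnd-++ P pivot rest)
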